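{- Let $r \geq 1$ and $n \geq 2$ be integers. Every maximal Sperner graph in $\mathcal{H}_v(2_r, 3; 4; n)$ is obtained from some maximal graph $G'$ in $\mathcal{H}_v(2_r, 3; 4; n - 1)$ by duplicating a vertex, i.e. by adding to $G'$ a new vertex $u$ whose neighborhood equals $N_{G'}(v)$ for some vertex $v \in V(G')$.
   Context: All graphs are finite, simple and undirected; $\omega(G)$ is the clique number, $\overline{G}$ the complement, and $N_G(v)$ the neighborhood of $v$ in $G$. For positive integers $a_1, \dots, a_s$, $G \overset{v}{\rightarrow} (a_1, \dots, a_s)$ means that for every coloring of $V(G)$ in $s$ colors there is $i$ such that $G$ contains a clique on $a_i$ vertices all of color $i$. $\mathcal{H}_v(a_1, \dots, a_s; q; n)$ is the set of graphs $G$ on $n$ vertices with $G \overset{v}{\rightarrow} (a_1, \dots, a_s)$ and $\omega(G) < q$. The notation $2_r$ stands for $r$ copies of $2$. A graph $G$ is a maximal graph in $\mathcal{H}_v(2_r, 3; 4; n)$ if $G \in \mathcal{H}_v(2_r, 3; 4; n)$ and $\omega(G + e) = 4$ for every edge $e$ of $\overline{G}$. A graph $G$ is a Sperner graph if $N_G(u) \subseteq N_G(v)$ for some pair of distinct vertices $u, v \in V(G)$. -}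

module Defs where

open import Data.Nat using (ℕ; zero; suc)
import Data.Nat
open import Data.Fin using (Fin; zero; suc)
open import Data.Bool using (Bool; true; false)
open import Data.Vec using (Vec; lookup; replicate; _++_; [_])
open import Data.Product using (Σ; ∃; _×_; _,_)
open import Data.Sum using (_⊎_)
open import Relation.Binary.PropositionalEquality using (_≡_; _≢_; refl)
open import Relation.Nullary using (¬_)
open import Function.Definitions using (Injective)
open import Function.Bundles using (_↔_; Inverse)

record Graph (n : ℕ) : Set where
  field
    edge   : Fin n → Fin n → Bool
    sym    : ∀ i j → edge i j ≡ edge j i
    irrefl : ∀ i → edge i i ≡ false
open Graph public

Adj : ∀ {n} → Graph n → Fin n → Fin n → Set
Adj G i j = edge G i j ≡ true

IsCliqueR : ∀ {n k} → (Fin n → Fin n → Set) → (Fin k → Fin n) → Set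
IsCliqueR R f = Injective _≡_ _≡_ f × (∀ i j → i ≢ j → R (f i) (f j))

HasCliqueR : ∀ {n} → (Fin n → Fin n → Set) → ℕ → Set
HasCliqueR {n} R k = Σ (Fin k → Fin n) (IsCliqueR R)

ωLess : ∀ {n} → Graph n → ℕ → Set
ωLess G q = ¬ HasCliqueR (Adj G) q

VArrows : ∀ {n s} → Graph n → Vec ℕ s → Set
VArrows {n} {s} G a =
  (c : Fin n → Fin s) →
  ∃ λ (i : Fin s) → Σ (Fin (lookup a i) → Fin n) λ f →
    IsCliqueR (Adj G) f × (∀ x → c (f x) ≡ i)

twos-three : (r : ℕ) → Vec ℕ (r Data.Nat.+ 1)
twos-three r = replicate r 2 ++ [ 3 ]

-- G ∈ H_v(2_r, 3; 4; n)  (the vertex count n is the index of Graph n)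
InH : ∀ {n} → ℕ → Graph n → Set
InH r G = VArrows G (twos-three r) × ωLess G 4

AdjPlus : ∀ {n} → Graph n → Fin n → Fin n → Fin n → Fin n → Set
AdjPlus G u v i j = Adj G i j ⊎ ((i ≡ u × j ≡ v) ⊎ (i ≡ v × j ≡ u))

MaximalH : ∀ {n} → ℕ → Graph n → Set
MaximalH {n} r G =
  InH r G ×
  (∀ (u v : Fin n) → u ≢ v → ¬ Adj G u v →
     HasCliqueR (AdjPlus G u v) 4 × ¬ HasCliqueR (AdjPlus G u v) 5)

Sperner : ∀ {n} → Graph n → Set
Sperner {n} G = Σ (Fin n) λ u → Σ (Fin n) λ v →
  u ≢ v × (∀ w → Adj G u w → Adj G v w)

-- Duplicating vertex v of G': new vertex (zero) with neighbourhood N_{G'}(v);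
-- old vertex i becomes suc i.
dupEdge : ∀ {m} → Graph m → Fin m → Fin (suc m) → Fin (suc m) → Bool
dupEdge G v zero    zero    = false
dupEdge G v zero    (suc j) = edge G v j
dupEdge G v (suc i) zero    = edge G i v
dupEdge G v (suc i) (suc j) = edge G i j

dupSym : ∀ {m} (G : Graph m) v i j → dupEdge G v i j ≡ dupEdge G v j i
dupSym G v zero    zero    = refl
dupSym G v zero    (suc j) = sym G v j
dupSym G v (suc i) zero    = sym G i v
dupSym G v (suc i) (suc j) = sym G i j

dupIrr : ∀ {m} (G : Graph m) v i → dupEdge G v i i ≡ false
dupIrr G v zero    = refl
dupIrr G v (suc i) = irrefl G i

duplicate : ∀ {m} → Graph m → Fin m → Graph (suc m)
duplicate G v = record { edge = dupEdge G v ; sym = dupSym G v ; irrefl = dupIrr G v }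

Iso : ∀ {n} → Graph n → Graph n → Set
Iso {n} G H = Σ (Fin n ↔ Fin n) λ σ →
  ∀ i j → edge G i j ≡ edge H (Inverse.to σ i) (Inverse.to σ j)

-- If N(u) ⊆ N(v) in a maximal K₄-free graph G, then u and v are twins: for
-- w ∈ N(v) ∖ N(u), the K₄ created by adding the edge uw becomes a K₄ of G once
-- u is identified with v, which is a homomorphism because N(u) ⊆ N(v).
-- Hence G is the duplication of v in G − u, and G − u is a retract of G:
-- arrowing is pulled back along the retraction, while K₄-freeness and
-- maximality pass between G − u and G along the embedding and the retraction.
module Submission where

open import Defs
open import Data.Nat using (ℕ; suc; _≤_)
open import Data.Fin using (Fin; zero; suc; punchIn; punchOut)
open import Data.Fin.Properties using (_≟_; punchIn-punchOut)
open import Data.Fin.Permutation using (insert; id; _⟨$⟩ʳ_; insert-punchIn)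
open import Data.Bool.Properties using (⇔→≡) renaming (_≟_ to _≟ᵇ_)
open import Data.Vec using (Vec)
open import Data.Product using (Σ; _×_; _,_; proj₁; proj₂)
open import Data.Sum using (inj₁; inj₂)
open import Function using (_∘_; Inverse; mk⇔)
open import Relation.Nullary using (¬_; yes; no; contradiction)
open import Relation.Nullary.Decidable using (decidable-stable)
open import Level using (0ℓ)
open import Relation.Binary using (Rel; Symmetric; Irreflexive)
open import Relation.Binary.Morphism.Definitions using (Homomorphic₂)
open import Relation.Binary.PropositionalEquality
  using (_≡_; _≢_; refl; trans; cong; cong₂; subst; subst₂)
  renaming (sym to ≡-sym)

private
  variable
    k m n : ℕ

Adj-sym : (G : Graph n) → Symmetric (Adj G)
Adj-sym G {a} {b} e = trans (sym G b a) e

Adj-irrefl : (G : Graph n) → Irreflexive _≡_ (Adj G)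
Adj-irrefl G {a} refl e with () ← trans (≡-sym e) (irrefl G a)

AdjPlus-irrefl : (G : Graph n) {x y : Fin n} → x ≢ y → Irreflexive _≡_ (AdjPlus G x y)
AdjPlus-irrefl G x≢y refl (inj₁ e)                    = Adj-irrefl G refl e
AdjPlus-irrefl G x≢y refl (inj₂ (inj₁ (refl , refl))) = x≢y refl
AdjPlus-irrefl G x≢y refl (inj₂ (inj₂ (refl , refl))) = x≢y refl

module _ {R : Rel (Fin n) 0ℓ} {S : Rel (Fin m) 0ℓ} {h : Fin n → Fin m}
         (hom : Homomorphic₂ _ _ R S h) where

  IsCliqueR-map : Irreflexive _≡_ S → {f : Fin k → Fin n} →
                  IsCliqueR R f → IsCliqueR S (h ∘ f)
  IsCliqueR-map S-irrefl {f} (f-injective , f-adjacent) =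
    h∘f-injective , λ i j i≢j → hom (f-adjacent i j i≢j)
    where
    h∘f-injective : ∀ {i j} → h (f i) ≡ h (f j) → i ≡ j
    h∘f-injective {i} {j} eq =
      decidable-stable (i ≟ j) λ i≢j → S-irrefl eq (hom (f-adjacent i j i≢j))

  HasCliqueR-map : Irreflexive _≡_ S → HasCliqueR R k → HasCliqueR S k
  HasCliqueR-map S-irrefl (f , clique) = h ∘ f , IsCliqueR-map S-irrefl clique

AdjPlus-hom : {G : Graph n} {S : Rel (Fin m) 0ℓ} {h : Fin n → Fin m} {x y : Fin n} →
              Homomorphic₂ _ _ (Adj G) S h → S (h x) (h y) → S (h y) (h x) →
              Homomorphic₂ _ _ (AdjPlus G x y) S h
AdjPlus-hom hom _  _  (inj₁ e)                    = hom e
AdjPlus-hom _   xy _  (inj₂ (inj₁ (refl , refl))) = xy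
AdjPlus-hom _   _  yx (inj₂ (inj₂ (refl , refl))) = yx

VArrows-map : {G : Graph n} {H : Graph m} {h : Fin n → Fin m} {s : ℕ} {a : Vec ℕ s} →
              Homomorphic₂ _ _ (Adj G) (Adj H) h → VArrows G a → VArrows H a
VArrows-map {G = G} {H} {h} hom arrows colouring with arrows (colouring ∘ h)
... | i , f , clique , monochromatic =
  i , h ∘ f , IsCliqueR-map {R = Adj G} hom (Adj-irrefl H) clique , monochromatic

record Retract (H : Graph m) (G : Graph n) : Set where
  field
    embed         : Fin m → Fin n
    project       : Fin n → Fin m
    embed-hom     : Homomorphic₂ _ _ (Adj H) (Adj G) embed
    project-hom   : Homomorphic₂ _ _ (Adj G) (Adj H) project
    project∘embed : ∀ x → project (embed x) ≡ x

Retract-∘ : {H : Graph m} {K : Graph k} {G : Graph n} →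
            Retract H K → Retract K G → Retract H G
Retract-∘ ρ τ = record
  { embed         = T.embed ∘ R.embed
  ; project       = R.project ∘ T.project
  ; embed-hom     = T.embed-hom ∘ R.embed-hom
  ; project-hom   = R.project-hom ∘ T.project-hom
  ; project∘embed = λ x → trans (cong R.project (T.project∘embed _)) (R.project∘embed x)
  }
  where
  module R = Retract ρ
  module T = Retract τ

Iso-retract : {G K : Graph n} → Iso G K → Retract K G
Iso-retract {G = G} {K} (σ , σ-edge) = record
  { embed         = from
  ; project       = to
  ; embed-hom     = λ {a} {b} e → trans (σ-edge (from a) (from b))
                      (trans (cong₂ (edge K) (strictlyInverseˡ a) (strictlyInverseˡ b)) e)
  ; project-hom   = λ {a} {b} e → trans (≡-sym (σ-edge a b)) e
  ; project∘embed = strictlyInverseˡ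
  }
  where open Inverse σ

duplicate-retract : (G : Graph m) (v : Fin m) → Retract G (duplicate G v)
duplicate-retract G v = record
  { embed         = suc
  ; project       = collapse
  ; embed-hom     = λ e → e
  ; project-hom   = λ {a} {b} → collapse-hom {a} {b}
  ; project∘embed = λ _ → refl
  }
  where
  collapse : Fin (suc _) → Fin _
  collapse zero    = v
  collapse (suc i) = i

  collapse-hom : Homomorphic₂ _ _ (Adj (duplicate G v)) (Adj G) collapse
  collapse-hom {zero}  {zero}  ()
  collapse-hom {zero}  {suc _} e = e
  collapse-hom {suc _} {zero}  e = e
  collapse-hom {suc _} {suc _} e = e

MaximalH-retract : {H : Graph m} {G : Graph n} {r : ℕ} →
                   Retract H G → MaximalH r G → MaximalH r H
MaximalH-retract {H = H} {G} {r} ρ ((arrows , K₄-free) , saturated) =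
  (arrows′ , K₄-free ∘ HasCliqueR-map {R = Adj H} embed-hom (Adj-irrefl G)) , saturated′
  where
  open Retract ρ

  arrows′ : VArrows H (twos-three r)
  arrows′ = VArrows-map {G = G} {H} {project} {a = twos-three r} project-hom arrows

  saturated′ : ∀ x y → x ≢ y → ¬ Adj H x y →
               HasCliqueR (AdjPlus H x y) 4 × ¬ HasCliqueR (AdjPlus H x y) 5
  saturated′ x y x≢y x≁y =
    HasCliqueR-map {R = AdjPlus G (embed x) (embed y)} project-plus (AdjPlus-irrefl H x≢y)
      (proj₁ created) ,
    proj₂ created ∘ HasCliqueR-map {R = AdjPlus H x y} embed-plus (AdjPlus-irrefl G ex≢ey)
    where
    ex≢ey : embed x ≢ embed y
    ex≢ey eq =
      x≢y (trans (≡-sym (project∘embed x)) (trans (cong project eq) (project∘embed y)))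

    ex≁ey : ¬ Adj G (embed x) (embed y)
    ex≁ey e = x≁y (subst₂ (Adj H) (project∘embed x) (project∘embed y) (project-hom e))

    created : HasCliqueR (AdjPlus G (embed x) (embed y)) 4 ×
              ¬ HasCliqueR (AdjPlus G (embed x) (embed y)) 5
    created = saturated (embed x) (embed y) ex≢ey ex≁ey

    project-plus : Homomorphic₂ _ _ (AdjPlus G (embed x) (embed y)) (AdjPlus H x y) project
    project-plus = AdjPlus-hom {G = G} {AdjPlus H x y} {project} (inj₁ ∘ project-hom)
      (inj₂ (inj₁ (project∘embed x , project∘embed y)))
      (inj₂ (inj₂ (project∘embed y , project∘embed x)))

    embed-plus : Homomorphic₂ _ _ (AdjPlus H x y) (AdjPlus G (embed x) (embed y)) embed
    embed-plus = AdjPlus-hom {G = H} {AdjPlus G (embed x) (embed y)} {embed} (inj₁ ∘ embed-hom)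
      (inj₂ (inj₁ (refl , refl)))
      (inj₂ (inj₂ (refl , refl)))

Saturated : ℕ → Graph n → Set
Saturated q G = ∀ x y → x ≢ y → ¬ Adj G x y → HasCliqueR (AdjPlus G x y) q

MaximalH⇒Saturated : {G : Graph n} {r : ℕ} → MaximalH r G → Saturated 4 G
MaximalH⇒Saturated (_ , saturated) x y x≢y x≁y = proj₁ (saturated x y x≢y x≁y)

identify : Fin n → Fin n → Fin n → Fin n
identify u v a with a ≟ u
... | yes _ = v
... | no  _ = a

identify-self : (u v : Fin n) → identify u v u ≡ v
identify-self u v with u ≟ u
... | yes _   = refl
... | no  u≢u = contradiction refl u≢u

identify-other : {u v a : Fin n} → a ≢ u → identify u v a ≡ a
identify-other {u = u} {v} {a} a≢u with a ≟ u
... | yes a≡u = contradiction a≡u a≢u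
... | no  _   = refl

identify-hom : (G : Graph n) {u v : Fin n} → (∀ w → Adj G u w → Adj G v w) →
               Homomorphic₂ _ _ (Adj G) (Adj G) (identify u v)
identify-hom G {u} {v} N⊆ {a} {b} e with a ≟ u | b ≟ u
... | yes refl | yes refl = contradiction e (Adj-irrefl G refl)
... | yes refl | no  _    = N⊆ b e
... | no  _    | yes refl = Adj-sym G (N⊆ a (Adj-sym G e))
... | no  _    | no  _    = e

Saturated⇒twins : {G : Graph n} {q : ℕ} {u v : Fin n} → ωLess G q → Saturated q G →
                  (∀ w → Adj G u w → Adj G v w) → ∀ w → edge G u w ≡ edge G v w
Saturated⇒twins {G = G} {q} {u} {v} K-free saturated N⊆ w = ⇔→≡ (mk⇔ (N⊆ w) N⊇)
  where
  N⊇ : Adj G v w → Adj G u w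
  N⊇ v∼w = decidable-stable (edge G u w ≟ᵇ _) λ u≁w →
    K-free (HasCliqueR-map {R = AdjPlus G u w} identify-plus (Adj-irrefl G)
      (saturated u w u≢w u≁w))
    where
    w≢u : w ≢ u
    w≢u refl = Adj-irrefl G refl (N⊆ v (Adj-sym G v∼w))

    u≢w : u ≢ w
    u≢w = w≢u ∘ ≡-sym

    v∼w′ : Adj G (identify u v u) (identify u v w)
    v∼w′ = subst₂ (Adj G) (≡-sym (identify-self u v)) (≡-sym (identify-other w≢u)) v∼w

    identify-plus : Homomorphic₂ _ _ (AdjPlus G u w) (Adj G) (identify u v)
    identify-plus =
      AdjPlus-hom {G = G} {Adj G} {identify u v} (identify-hom G N⊆) v∼w′ (Adj-sym G v∼w′)

delete : Graph (suc m) → Fin (suc m) → Graph m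
delete G u = record
  { edge   = λ i j → edge G (punchIn u i) (punchIn u j)
  ; sym    = λ i j → sym G (punchIn u i) (punchIn u j)
  ; irrefl = λ i → irrefl G (punchIn u i)
  }

data PunchedIn (u : Fin (suc m)) : Fin (suc m) → Set where
  here  : PunchedIn u u
  there : (i : Fin m) → PunchedIn u (punchIn u i)

punchedIn : (u a : Fin (suc m)) → PunchedIn u a
punchedIn u a with u ≟ a
... | yes refl = here
... | no  u≢a  = subst (PunchedIn u) (punchIn-punchOut u≢a) (there (punchOut u≢a))

twins-iso : (G : Graph (suc m)) (u : Fin (suc m)) (v : Fin m) →
            (∀ w → edge G u w ≡ edge G (punchIn u v) w) → Iso G (duplicate (delete G u) v)
twins-iso G u v twins = σ , λ i j → σ-edge (punchedIn u i) (punchedIn u j)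
  where
  σ = insert u zero id

  σ-here : σ ⟨$⟩ʳ u ≡ zero
  σ-here with u ≟ u
  ... | yes _   = refl
  ... | no  u≢u = contradiction refl u≢u

  σ-there : ∀ i → σ ⟨$⟩ʳ punchIn u i ≡ suc i
  σ-there = insert-punchIn u zero id

  σ-edge : ∀ {i j} → PunchedIn u i → PunchedIn u j →
           edge G i j ≡ edge (duplicate (delete G u) v) (σ ⟨$⟩ʳ i) (σ ⟨$⟩ʳ j)
  σ-edge here      here      rewrite σ-here             = irrefl G u
  σ-edge here      (there j) rewrite σ-here | σ-there j = twins (punchIn u j)
  σ-edge (there i) here      rewrite σ-here | σ-there i =
    trans (sym G (punchIn u i) u) (trans (twins (punchIn u i)) (sym G (punchIn u v) (punchIn u i)))
  σ-edge (there i) (there j) rewrite σ-there i | σ-there j = refl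

mainTheorem5 : (r m : ℕ) → 1 ≤ r → 1 ≤ m → (G : Graph (suc m)) →
    MaximalH r G → Sperner G →
    Σ (Graph m) λ G' → MaximalH r G' × Σ (Fin m) λ v → Iso G (duplicate G' v)
mainTheorem5 r m _ _ G maximal@((_ , K₄-free) , _) (u , v , u≢v , N⊆) with punchedIn u v
... | here     = contradiction refl u≢v
... | there v′ = delete G u , MaximalH-retract retract maximal , v′ , iso
  where
  iso : Iso G (duplicate (delete G u) v′)
  iso = twins-iso G u v′
    (Saturated⇒twins {G = G} K₄-free (MaximalH⇒Saturated {G = G} {r} maximal) N⊆)

  retract : Retract (delete G u) G
  retract = Retract-∘ (duplicate-retract (delete G u) v′) (Iso-retract iso)
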